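{- Let $(P,\leq,{}')$ be a poset with a unary operation ${}'$, and define mappings $M,R:P^2\to 2^P$ by $M(x,y)=L(U(x,y'),y)$ and $R(x,y)=L(U(L(y,x),x'))$. If $L(x)\subseteq L(U(L(U(x,y'),y),y'))$ for all $x,y\in P$, then for all $x,y,z\in P$, $M(x,y)\subseteq L(z)$ implies $L(x)\subseteq R(y,z)$. If $L(U(L(x,y),y'),y)\subseteq L(x)$ for all $x,y\in P$, then for all $x,y,z\in P$, $L(x)\subseteq R(y,z)$ implies $M(x,y)\subseteq L(z)$.
   Context: For a poset $(P,\leq)$ and $A\subseteq P$ let $L(A)=\{x\in P\mid x\leq a\text{ for all }a\in A\}$ and $U(A)=\{x\in P\mid a\leq x\text{ for all }a\in A\}$; write $L(x)=L(\{x\})$, and when several elements or subsets are listed as arguments the union of them is meant, e.g. $L(x,y)=L(\{x,y\})$, $U(x,y')=U(\{x,y'\})$, $L(U(x,y'),y)=L(U(\{x,y'\})\cup\{y\})$, $L(U(L(y,x),x'))=L(U(L(\{x,y\})\cup\{x'\}))$. -}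

module Defs where

open import Level using (Level; _⊔_)
open import Relation.Binary.Core using (Rel)
open import Relation.Unary using (Pred; ｛_｝; _∪_; _⊆_)

module Cones {a ℓ : Level} {P : Set a} (_≤_ : Rel P ℓ) where

  L : ∀ {ℓ₁} → Pred P ℓ₁ → Pred P (a ⊔ ℓ ⊔ ℓ₁)
  L A x = ∀ t → A t → x ≤ t

  U : ∀ {ℓ₁} → Pred P ℓ₁ → Pred P (a ⊔ ℓ ⊔ ℓ₁)
  U A x = ∀ t → A t → t ≤ x

  module WithOp (_′ : P → P) where

    M : P → P → Pred P (a ⊔ ℓ)
    M x y = L (U (｛ x ｝ ∪ ｛ y ′ ｝) ∪ ｛ y ｝)

    R : P → P → Pred P (a ⊔ ℓ)
    R x y = L (U (L (｛ y ｝ ∪ ｛ x ｝) ∪ ｛ x ′ ｝))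

    Hyp₁ : Set (a ⊔ ℓ)
    Hyp₁ = ∀ x y → L ｛ x ｝ ⊆ L (U (L (U (｛ x ｝ ∪ ｛ y ′ ｝) ∪ ｛ y ｝) ∪ ｛ y ′ ｝))

    Hyp₂ : Set (a ⊔ ℓ)
    Hyp₂ = ∀ x y → L (U (L (｛ x ｝ ∪ ｛ y ｝) ∪ ｛ y ′ ｝) ∪ ｛ y ｝) ⊆ L ｛ x ｝

module Submission where

open import Defs
open import Level using (Level)
open import Data.Product using (_×_; _,_)
open import Data.Sum using (inj₁; inj₂)
open import Relation.Binary.Core using (Rel)
open import Relation.Binary.Definitions using (Reflexive)
open import Relation.Binary.Structures using (IsPartialOrder)
open import Relation.Binary.PropositionalEquality using (_≡_; refl)
open import Relation.Unary using (Pred; _∈_; ｛_｝; _∪_; _⊆_)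

-- Both parts come from the antitone Galois connection between L and U.
-- For the first, M(x,y) ⊆ L(z) and M(x,y) ⊆ L(y) give M(x,y) ⊆ L(z,y), so
-- L(U(M(x,y),y')) ⊆ R(y,z), and the hypothesis puts L(x) inside the former.
-- For the second, x ∈ R(y,z) means U(L(z,y),y') ⊆ U(x), hence ⊆ U(x,y'), so
-- M(x,y) ⊆ L(U(L(z,y),y'),y), which the hypothesis (at z, y) puts inside L(z).

module ConeProperties {a ℓ : Level} {P : Set a} (_≤_ : Rel P ℓ) where

  open Cones _≤_

  L-antitone : ∀ {ℓ₁ ℓ₂} {A : Pred P ℓ₁} {B : Pred P ℓ₂} → A ⊆ B → L B ⊆ L A
  L-antitone A⊆B x∈LB t t∈A = x∈LB t (A⊆B t∈A)

  L-∪-antitoneˡ : ∀ {ℓ₁ ℓ₂ ℓ₃} {A : Pred P ℓ₁} {B : Pred P ℓ₂} (C : Pred P ℓ₃) →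
                  A ⊆ B → L (B ∪ C) ⊆ L (A ∪ C)
  L-∪-antitoneˡ C A⊆B x∈L t (inj₁ t∈A) = x∈L t (inj₁ (A⊆B t∈A))
  L-∪-antitoneˡ C A⊆B x∈L t (inj₂ t∈C) = x∈L t (inj₂ t∈C)

  U-∪-antitoneˡ : ∀ {ℓ₁ ℓ₂ ℓ₃} {A : Pred P ℓ₁} {B : Pred P ℓ₂} (C : Pred P ℓ₃) →
                  A ⊆ B → U (B ∪ C) ⊆ U (A ∪ C)
  U-∪-antitoneˡ C A⊆B x∈U t (inj₁ t∈A) = x∈U t (inj₁ (A⊆B t∈A))
  U-∪-antitoneˡ C A⊆B x∈U t (inj₂ t∈C) = x∈U t (inj₂ t∈C)

  L-∪⁻ʳ : ∀ {ℓ₁ ℓ₂} (A : Pred P ℓ₁) (B : Pred P ℓ₂) → L (A ∪ B) ⊆ L B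
  L-∪⁻ʳ A B x∈L t t∈B = x∈L t (inj₂ t∈B)

  U-∪⁻ʳ : ∀ {ℓ₁ ℓ₂} (A : Pred P ℓ₁) (B : Pred P ℓ₂) → U (A ∪ B) ⊆ U B
  U-∪⁻ʳ A B x∈U t t∈B = x∈U t (inj₂ t∈B)

  ⊆-L-∪ : ∀ {ℓ₁ ℓ₂ ℓ₃} {S : Pred P ℓ₁} {A : Pred P ℓ₂} {B : Pred P ℓ₃} →
          S ⊆ L A → S ⊆ L B → S ⊆ L (A ∪ B)
  ⊆-L-∪ S⊆LA S⊆LB x∈S t (inj₁ t∈A) = S⊆LA x∈S t t∈A
  ⊆-L-∪ S⊆LA S⊆LB x∈S t (inj₂ t∈B) = S⊆LB x∈S t t∈B

  ⊆-U-∪ : ∀ {ℓ₁ ℓ₂ ℓ₃} {S : Pred P ℓ₁} {A : Pred P ℓ₂} {B : Pred P ℓ₃} →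
          S ⊆ U A → S ⊆ U B → S ⊆ U (A ∪ B)
  ⊆-U-∪ S⊆UA S⊆UB x∈S t (inj₁ t∈A) = S⊆UA x∈S t t∈A
  ⊆-U-∪ S⊆UA S⊆UB x∈S t (inj₂ t∈B) = S⊆UB x∈S t t∈B

  ∈L⇒⊆U : ∀ {ℓ₁} {A : Pred P ℓ₁} {x : P} → x ∈ L A → A ⊆ U ｛ x ｝
  ∈L⇒⊆U x∈LA {t} t∈A _ refl = x∈LA t t∈A

  ∈L-｛｝ : Reflexive _≤_ → ∀ {x} → x ∈ L ｛ x ｝
  ∈L-｛｝ ≤-refl _ refl = ≤-refl

  module _ (_′ : P → P) where

    open WithOp _′

    M⊆L⇒L⊆R : Hyp₁ → ∀ x y z → M x y ⊆ L ｛ z ｝ → L ｛ x ｝ ⊆ R y z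
    M⊆L⇒L⊆R hyp₁ x y z M⊆Lz w∈Lx = L-antitone (U-∪-antitoneˡ ｛ y ′ ｝ M⊆L[z,y]) (hyp₁ x y w∈Lx)
      where
      M⊆L[z,y] : M x y ⊆ L (｛ z ｝ ∪ ｛ y ｝)
      M⊆L[z,y] = ⊆-L-∪ M⊆Lz (L-∪⁻ʳ (U (｛ x ｝ ∪ ｛ y ′ ｝)) ｛ y ｝)

    L⊆R⇒M⊆L : Reflexive _≤_ → Hyp₂ → ∀ x y z → L ｛ x ｝ ⊆ R y z → M x y ⊆ L ｛ z ｝
    L⊆R⇒M⊆L ≤-refl hyp₂ x y z Lx⊆R w∈M = hyp₂ z y (L-∪-antitoneˡ ｛ y ｝ U[L[z,y],y′]⊆U[x,y′] w∈M)
      where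
      U[L[z,y],y′]⊆U[x,y′] : U (L (｛ z ｝ ∪ ｛ y ｝) ∪ ｛ y ′ ｝) ⊆ U (｛ x ｝ ∪ ｛ y ′ ｝)
      U[L[z,y],y′]⊆U[x,y′] = ⊆-U-∪ (∈L⇒⊆U (Lx⊆R (∈L-｛｝ ≤-refl))) (U-∪⁻ʳ (L (｛ z ｝ ∪ ｛ y ｝)) ｛ y ′ ｝)

lemma2 : ∀ {a ℓ : Level} (P : Set a) (_≤_ : Rel P ℓ) → IsPartialOrder _≡_ _≤_ → (_′ : P → P) →
    (Cones.WithOp.Hyp₁ _≤_ _′ → ∀ x y z →
       Cones.WithOp.M _≤_ _′ x y ⊆ Cones.L _≤_ ｛ z ｝ →
       Cones.L _≤_ ｛ x ｝ ⊆ Cones.WithOp.R _≤_ _′ y z)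
    × (Cones.WithOp.Hyp₂ _≤_ _′ → ∀ x y z →
       Cones.L _≤_ ｛ x ｝ ⊆ Cones.WithOp.R _≤_ _′ y z →
       Cones.WithOp.M _≤_ _′ x y ⊆ Cones.L _≤_ ｛ z ｝)
lemma2 P _≤_ po _′ = M⊆L⇒L⊆R _′ , L⊆R⇒M⊆L _′ (IsPartialOrder.refl po)
  where open ConeProperties _≤_
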